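{- Let $\delta$ be a composition of $n$, let $\omega\in\Omega_\delta$ with content $\gamma$, and let $\hat\gamma$ be the content of the minimal sequence $\hat\omega\in\Omega_\delta$. Then $\hat\gamma=\mathrm{srt}(\delta)$ and $\hat\gamma\trianglelefteq\gamma$.
   Context: A composition of $n$ is a finite sequence $\delta=(\delta_1,\dots,\delta_r)$ of positive integers summing to $n$; $N^\delta_\ell:=\{\delta_1+\cdots+\delta_{\ell-1}+1,\dots,\delta_1+\cdots+\delta_\ell\}$. A lattice permutation is a finite sequence $(\omega_1,\dots,\omega_s)$ of positive integers such that for each $k\le s$ and each $a<b$, $|\{i\le k:\omega_i=a\}|\ge|\{i\le k:\omega_i=b\}|$. A sequence of length $m\le n$ is $\delta$-nonincreasing if, after appending $n-m$ entries equal to $1$, it is nonincreasing on each $N^\delta_\ell$. $\Omega_\delta$ is the set of sequences of $n$ positive integers that are lattice permutations and $\delta$-nonincreasing. The minimal sequence $\hat\omega$ is defined by $\hat\omega_1=1$ and, recursively, $\hat\omega_i$ is the largest positive integer such that $(\hat\omega_1,\dots,\hat\omega_i)$ is a lattice permutation and $\delta$-nonincreasing. The content of a sequence $\omega$ is $(\gamma_1,\gamma_2,\dots)$ with $\gamma_i$ the number of entries equal to $i$. $\mathrm{srt}(\delta)$ is $\delta$ sorted in nonincreasing order. Dominance: $\hat\gamma\trianglelefteq\gamma$ means $\sum_{i=1}^r(\gamma_i-\hat\gamma_i)\ge0$ for all $r$. -}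

module Defs where

open import Data.Nat using (ℕ; zero; suc; _+_; _≤_; _<_; _≥_)
open import Data.Nat.Properties using (_≟_; ≤-decTotalOrder)
open import Data.List using (List; []; _∷_; _++_; [_]; length; take; drop; replicate; reverse)
open import Data.Nat.ListAction using (sum)
open import Relation.Nullary using (yes; no)
open import Data.List.Relation.Unary.All using (All)
open import Data.List.Relation.Unary.Linked using (Linked)
open import Data.Product using (Σ; _×_)
open import Relation.Binary.PropositionalEquality using (_≡_)
open import Data.List.Sort ≤-decTotalOrder using (sort)

IsComposition : ℕ → List ℕ → Set
IsComposition n δ = All (λ d → 1 ≤ d) δ × sum δ ≡ n

Positive : List ℕ → Set
Positive ω = All (λ x → 1 ≤ x) ω

occ : ℕ → List ℕ → ℕ
occ a [] = 0
occ a (x ∷ ω) with x ≟ a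
... | yes _ = suc (occ a ω)
... | no _ = occ a ω

LatticePerm : List ℕ → Set
LatticePerm ω = ∀ k a b → k ≤ length ω → 1 ≤ a → a < b →
  occ b (take k ω) ≤ occ a (take k ω)

blocks : List ℕ → List ℕ → List (List ℕ)
blocks [] xs = []
blocks (d ∷ δ) xs = take d xs ∷ blocks δ (drop d xs)

Nonincreasing : List ℕ → Set
Nonincreasing = Linked _≥_

DeltaNonincreasing : ℕ → List ℕ → List ℕ → Set
DeltaNonincreasing n δ ω =
  length ω ≤ n × All Nonincreasing (blocks δ (ω ++ replicate (n Data.Nat.∸ length ω) 1))

Admissible : ℕ → List ℕ → List ℕ → Set
Admissible n δ ω = Positive ω × LatticePerm ω × DeltaNonincreasing n δ ω

InΩ : ℕ → List ℕ → List ℕ → Set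
InΩ n δ ω = length ω ≡ n × Admissible n δ ω

IsMinimalSeq : ℕ → List ℕ → List ℕ → Set
IsMinimalSeq n δ ω̂ =
  length ω̂ ≡ n × take 1 ω̂ ≡ take n [ 1 ] ×
  (∀ i → i < n → Σ ℕ λ v →
     take (suc i) ω̂ ≡ take i ω̂ ++ [ v ] × 1 ≤ v ×
     Admissible n δ (take i ω̂ ++ [ v ]) ×
     (∀ w → 1 ≤ w → Admissible n δ (take i ω̂ ++ [ w ]) → w ≤ v))

content : List ℕ → ℕ → ℕ
content ω i = occ i ω

-- i-th entry (1-indexed) of a list, 0 beyond its end (and at index 0)
entry : List ℕ → ℕ → ℕ
entry [] i = 0
entry (x ∷ xs) zero = 0
entry (x ∷ xs) (suc zero) = x
entry (x ∷ xs) (suc (suc i)) = entry xs (suc i)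

srt : List ℕ → List ℕ
srt δ = reverse (sort δ)

psum : (ℕ → ℕ) → ℕ → ℕ
psum f zero = 0
psum f (suc r) = psum f r + f (suc r)

-- dominance γ̂ ⊴ γ : Σ_{i=1}^r (γᵢ − γ̂ᵢ) ≥ 0 for all r (stated in ℕ)
Dominated : (ℕ → ℕ) → (ℕ → ℕ) → Set
Dominated γ̂ γ = ∀ r → psum γ̂ r ≤ psum γ r

-- Write ps_r(ω) for the number of entries of ω in {1, …, r} and read ω block by block along δ.
-- In a nonincreasing block every entry above r+1 must, by the lattice condition, be matched by an
-- earlier occurrence of r+1; hence once the blocks of parts d₁, …, d_k have been read, ps_r is at
-- least the sum of the r largest of d₁, …, d_k.  The minimal sequence fills each block greedily with
-- the largest appendable value not exceeding the previous entry, which places as many entries above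
-- r+1 as the lattice condition permits, so for ω̂ all these bounds are equalities.  Thus ps_r(ω̂) is
-- the sum of the r largest parts, i.e. γ̂ = srt δ, and ps_r(ω̂) ≤ ps_r(ω) is the dominance γ̂ ⊴ γ.

module Submission where

open import Defs
open import Algebra.Properties.CommutativeSemigroup using (interchange)
open import Data.Bool using (true; false)
open import Data.Empty using (⊥-elim)
open import Data.Nat using (ℕ; zero; suc; pred; _+_; _∸_; _⊔_; _⊓_; _≤_; _<_; z≤n; s≤s; _≤?_; _<?_; _≤ᵇ_)
open import Data.Nat.Properties
open import Data.Nat.ListAction using (sum)
open import Data.Nat.ListAction.Properties using (sum-++)
open import Data.List using (List; []; _∷_; _++_; [_]; length; take; drop; replicate; reverse; foldl; foldr)
open import Data.List.Properties
  using (++-assoc; ++-identityʳ; length-++; length-++-≤ˡ; take-[]; take-all; length-take; length-drop; drop-all;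
         take++drop≡id; ∷-injectiveˡ; ∷-injectiveʳ; unfold-reverse; reverse-involutive)
open import Data.List.Relation.Unary.All as All using (All; []; _∷_)
import Data.List.Relation.Unary.All.Properties as Allₚ
open import Data.List.Relation.Unary.AllPairs using (AllPairs; []; _∷_)
import Data.List.Relation.Unary.AllPairs.Properties as AllPairs
open import Data.List.Relation.Unary.Linked as Linked using (Linked; []; [-]; _∷_)
open import Data.List.Relation.Unary.Linked.Properties using (Linked⇒AllPairs; AllPairs⇒Linked)
open import Data.List.Relation.Binary.Permutation.Propositional using (_↭_; ↭-refl; ↭-trans; ↭-sym; ↭⇒↭ₛ)
open import Data.List.Relation.Binary.Permutation.Propositional.Properties using (shift; ↭-reverse; ++⁺ˡ)
open import Data.List.Relation.Binary.Pointwise using (Pointwise-≡⇒≡)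
import Data.List.Relation.Unary.Sorted.TotalOrder.Properties as Sorted
open import Data.List.Sort ≤-decTotalOrder using (sort; sort-↭; sort-↗)
open import Relation.Binary.Properties.DecTotalOrder ≤-decTotalOrder using (≥-decTotalOrder)
open import Data.List.Sort.InsertionSort ≥-decTotalOrder using (insert)
import Data.List.Sort.InsertionSort.Properties ≥-decTotalOrder as Insertion
open import Data.Product using (Σ; _×_; _,_)
open import Data.Sum using (inj₁; inj₂)
open import Data.Unit using (⊤; tt)
open import Function using (_∘_; flip)
open import Relation.Nullary using (yes; no; ¬_; Dec)
open import Relation.Nullary.Reflects using (ofʸ; ofⁿ)
open import Relation.Binary.PropositionalEquality
  using (_≡_; _≢_; refl; sym; trans; cong; cong₂; subst; subst₂; module ≡-Reasoning)

take-++-≤ : ∀ {A : Set} k (p q : List A) → k ≤ length p → take k (p ++ q) ≡ take k p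
take-++-≤ zero    p       q _         = refl
take-++-≤ (suc k) (x ∷ p) q (s≤s k≤p) = cong (x ∷_) (take-++-≤ k p q k≤p)

drop-++-≤ : ∀ {A : Set} k (p q : List A) → k ≤ length p → drop k (p ++ q) ≡ drop k p ++ q
drop-++-≤ zero    p       q _         = refl
drop-++-≤ (suc k) (x ∷ p) q (s≤s k≤p) = drop-++-≤ k p q k≤p

take-++-+ : ∀ {A : Set} (p : List A) k q → take (length p + k) (p ++ q) ≡ p ++ take k q
take-++-+ []      k q = refl
take-++-+ (x ∷ p) k q = cong (x ∷_) (take-++-+ p k q)

drop-++-+ : ∀ {A : Set} (p : List A) k q → drop (length p + k) (p ++ q) ≡ drop k q
drop-++-+ []      k q = refl
drop-++-+ (x ∷ p) k q = drop-++-+ p k q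

length-take-≡ : ∀ {A : Set} (xs : List A) {d e} → length xs ≡ d + e → length (take d xs) ≡ d
length-take-≡ xs {d} {e} |xs|≡ = trans (length-take d xs) (trans (cong (d ⊓_) |xs|≡) (m≤n⇒m⊓n≡m (m≤m+n d e)))

length-drop-≡ : ∀ {A : Set} (xs : List A) {d e} → length xs ≡ d + e → length (drop d xs) ≡ e
length-drop-≡ xs {d} {e} |xs|≡ = trans (length-drop d xs) (trans (cong (_∸ d) |xs|≡) (m+n∸m≡n d e))

++-take++drop : ∀ {A : Set} (P : List A) d xs → (P ++ take d xs) ++ drop d xs ≡ P ++ xs
++-take++drop P d xs = trans (++-assoc P (take d xs) (drop d xs)) (cong (P ++_) (take++drop≡id d xs))

length-∷ʳ-+ : ∀ {A : Set} (q : List A) {x k d} → length q + suc k ≡ d → length (q ++ [ x ]) + k ≡ d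
length-∷ʳ-+ q {k = k} len = trans (cong (_+ k) (length-++ q)) (trans (+-assoc (length q) 1 k) len)

drop≡∷ : ∀ {A : Set} i (xs : List A) {v} → take (suc i) xs ≡ take i xs ++ [ v ] → drop i xs ≡ v ∷ drop (suc i) xs
drop≡∷ zero    (x ∷ xs) eq = cong (_∷ xs) (∷-injectiveˡ eq)
drop≡∷ (suc i) (x ∷ xs) eq = drop≡∷ i xs (∷-injectiveʳ eq)

All-reverse : ∀ {A : Set} {P : A → Set} {xs} → All P xs → All P (reverse xs)
All-reverse []                        = []
All-reverse {xs = x ∷ xs} (px ∷ pxs) rewrite unfold-reverse x xs = Allₚ.++⁺ (All-reverse pxs) (px ∷ [])

AllPairs-reverse : ∀ {A : Set} {R : A → A → Set} {xs} → AllPairs R xs → AllPairs (flip R) (reverse xs)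
AllPairs-reverse []                        = []
AllPairs-reverse {xs = x ∷ xs} (px ∷ pxs) rewrite unfold-reverse x xs =
  AllPairs.++⁺ (AllPairs-reverse pxs) ([] ∷ []) (All.map (_∷ []) (All-reverse px))

-- Sums of the largest parts

insertAll : List ℕ → List ℕ → List ℕ
insertAll δ S = foldl (λ T d → insert d T) S δ

insertAll-↗ : ∀ δ {S} → Nonincreasing S → Nonincreasing (insertAll δ S)
insertAll-↗ []      S↘ = S↘
insertAll-↗ (d ∷ δ) S↘ = insertAll-↗ δ (Insertion.insert-↗ d S↘)

insertAll-↭ : ∀ δ S → insertAll δ S ↭ δ ++ S
insertAll-↭ []      S = ↭-refl
insertAll-↭ (d ∷ δ) S =
  ↭-trans (insertAll-↭ δ (insert d S)) (↭-trans (++⁺ˡ δ (Insertion.insert-↭ d S)) (shift d δ S))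

reverse-↘ : ∀ {xs} → Nonincreasing xs → Linked _≤_ (reverse xs)
reverse-↘ = AllPairs⇒Linked ∘ AllPairs-reverse ∘ Linked⇒AllPairs (flip ≤-trans)

srt≡insertAll : ∀ δ → srt δ ≡ insertAll δ []
srt≡insertAll δ = trans (cong reverse sort≡) (reverse-involutive (insertAll δ []))
  where
  T : List ℕ
  T = insertAll δ []
  T↭δ : reverse T ↭ δ
  T↭δ = ↭-trans (↭-reverse T) (subst (T ↭_) (++-identityʳ δ) (insertAll-↭ δ []))
  sort≡ : sort δ ≡ reverse T
  sort≡ = Pointwise-≡⇒≡ (Sorted.↗↭↗⇒≋ ≤-totalOrder (sort-↗ δ) (reverse-↘ (insertAll-↗ δ []))
            (↭⇒↭ₛ (↭-trans (sort-↭ δ) (↭-sym T↭δ))))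

entry-≤-head : ∀ {x} S i → Nonincreasing (x ∷ S) → entry S i ≤ x
entry-≤-head []      i             _            = z≤n
entry-≤-head (y ∷ S) zero          _            = z≤n
entry-≤-head (y ∷ S) (suc zero)    (y≤x ∷ _)    = y≤x
entry-≤-head (y ∷ S) (suc (suc i)) (y≤x ∷ S↘)   = ≤-trans (entry-≤-head S (suc i) S↘) y≤x

sum-take-[] : ∀ r → sum (take r []) ≡ 0
sum-take-[] r = cong sum (take-[] r)

sum-take-suc : ∀ r S → sum (take (suc r) S) ≡ sum (take r S) + entry S (suc r)
sum-take-suc r       []      = sym (trans (+-identityʳ _) (sum-take-[] r))
sum-take-suc zero    (x ∷ S) = +-identityʳ x
sum-take-suc (suc r) (x ∷ S) = trans (cong (x +_) (sum-take-suc r S)) (sym (+-assoc x _ _))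

sum-take-insert : ∀ r d S → Nonincreasing S →
  sum (take (suc r) (insert d S)) ≡ sum (take r S) + (entry S (suc r) ⊔ d)
sum-take-insert r d [] _ = +-comm d _
-- insert compares by x ≤ᵇ d (the flipped order), so split on that boolean rather than on x ≤? d
sum-take-insert zero d (x ∷ S) _ with x ≤ᵇ d | ≤ᵇ-reflects-≤ x d
... | true  | ofʸ x≤d = trans (+-identityʳ d) (sym (m≤n⇒m⊔n≡n x≤d))
... | false | ofⁿ x≰d = trans (+-identityʳ x) (sym (m≥n⇒m⊔n≡m (≰⇒≥ x≰d)))
sum-take-insert (suc r) d (x ∷ S) S↘ with x ≤ᵇ d | ≤ᵇ-reflects-≤ x d
... | true  | ofʸ x≤d = begin
    d + (x + sum (take r S))                  ≡⟨ +-comm d _ ⟩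
    x + sum (take r S) + d                    ≡⟨ cong (x + sum (take r S) +_) (sym (m≤n⇒m⊔n≡n e≤d)) ⟩
    x + sum (take r S) + (entry S (suc r) ⊔ d)  ∎
  where
  open ≡-Reasoning
  e≤d : entry S (suc r) ≤ d
  e≤d = ≤-trans (entry-≤-head S (suc r) S↘) x≤d
... | false | ofⁿ _ = trans (cong (x +_) (sum-take-insert r d S (Linked.tail S↘))) (sym (+-assoc x _ _))

-- Counting entries

occ-++ : ∀ a p q → occ a (p ++ q) ≡ occ a p + occ a q
occ-++ a []      q = refl
occ-++ a (x ∷ p) q with x ≟ a
... | yes _ = cong suc (occ-++ a p q)
... | no  _ = occ-++ a p q

occ-≤-++ : ∀ a p q → occ a p ≤ occ a (p ++ q)
occ-≤-++ a p q = subst (occ a p ≤_) (sym (occ-++ a p q)) (m≤m+n _ _)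

occ-∷-≡ : ∀ a p → occ a (a ∷ p) ≡ suc (occ a p)
occ-∷-≡ a p with a ≟ a
... | yes _  = refl
... | no a≢a = ⊥-elim (a≢a refl)

occ-∷-≢ : ∀ {a x} p → x ≢ a → occ a (x ∷ p) ≡ occ a p
occ-∷-≢ {a} {x} p x≢a with x ≟ a
... | yes x≡a = ⊥-elim (x≢a x≡a)
... | no  _   = refl

occ-∷ʳ-≡ : ∀ a p → occ a (p ++ [ a ]) ≡ suc (occ a p)
occ-∷ʳ-≡ a p = trans (occ-++ a p [ a ]) (trans (cong (occ a p +_) (occ-∷-≡ a [])) (+-comm (occ a p) 1))

occ-∷ʳ-≢ : ∀ {a x} p → x ≢ a → occ a (p ++ [ x ]) ≡ occ a p
occ-∷ʳ-≢ {a} p x≢a = trans (occ-++ a p _) (trans (cong (occ a p +_) (occ-∷-≢ [] x≢a)) (+-identityʳ (occ a p)))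

psum-cong : ∀ {f g} → (∀ i → f i ≡ g i) → ∀ r → psum f r ≡ psum g r
psum-cong f≗g zero    = refl
psum-cong f≗g (suc r) = cong₂ _+_ (psum-cong f≗g r) (f≗g (suc r))

psum-+ : ∀ f g r → psum (λ i → f i + g i) r ≡ psum f r + psum g r
psum-+ f g zero    = refl
psum-+ f g (suc r) = trans (cong (_+ (f (suc r) + g (suc r))) (psum-+ f g r))
  (interchange +-commutativeSemigroup (psum f r) (psum g r) (f (suc r)) (g (suc r)))

psum-content-[] : ∀ r → psum (content []) r ≡ 0
psum-content-[] zero    = refl
psum-content-[] (suc r) = cong (_+ 0) (psum-content-[] r)

psum-content-++ : ∀ p q r → psum (content (p ++ q)) r ≡ psum (content p) r + psum (content q) r
psum-content-++ p q r = trans (psum-cong (λ i → occ-++ i p q) r) (psum-+ (content p) (content q) r)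

countAbove : ℕ → List ℕ → ℕ
countAbove r []      = 0
countAbove r (x ∷ b) with r <? x
... | yes _ = suc (countAbove r b)
... | no  _ = countAbove r b

countAbove-∷-> : ∀ {r x} b → r < x → countAbove r (x ∷ b) ≡ suc (countAbove r b)
countAbove-∷-> {r} {x} b r<x with r <? x
... | yes _   = refl
... | no  r≮x = ⊥-elim (r≮x r<x)

countAbove-∷-≤ : ∀ {r x} b → x ≤ r → countAbove r (x ∷ b) ≡ countAbove r b
countAbove-∷-≤ {r} {x} b x≤r with r <? x
... | yes r<x = ⊥-elim (<⇒≱ r<x x≤r)
... | no  _   = refl

countAbove-↘ : ∀ {r y} b → Nonincreasing (y ∷ b) → y ≤ r → countAbove r (y ∷ b) ≡ 0
countAbove-↘ []      _            y≤r = countAbove-∷-≤ [] y≤r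
countAbove-↘ (z ∷ b) (z≤y ∷ b↘)   y≤r =
  trans (countAbove-∷-≤ (z ∷ b) y≤r) (countAbove-↘ b b↘ (≤-trans z≤y y≤r))

countAbove-zero : ∀ {b} → Positive b → countAbove 0 b ≡ length b
countAbove-zero []                = refl
countAbove-zero {x ∷ b} (1≤x ∷ b⁺) = trans (countAbove-∷-> b 1≤x) (cong suc (countAbove-zero b⁺))

occ+countAbove : ∀ r b → occ (suc r) b + countAbove (suc r) b ≡ countAbove r b
occ+countAbove r []      = refl
occ+countAbove r (x ∷ b) with x ≟ suc r | suc r <? x | r <? x
... | yes refl | no  _      | yes _   = cong suc (occ+countAbove r b)
... | yes refl | yes r+1<x  | _       = ⊥-elim (<-irrefl refl r+1<x)
... | yes refl | no  _      | no  r≮x = ⊥-elim (r≮x ≤-refl)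
... | no  _    | yes _      | yes _   = trans (+-suc _ _) (cong suc (occ+countAbove r b))
... | no  _    | yes r+1<x  | no  r≮x = ⊥-elim (r≮x (<-trans (n<1+n r) r+1<x))
... | no  x≢   | no  r+1≮x  | yes r<x = ⊥-elim (x≢ (≤-antisym (≮⇒≥ r+1≮x) r<x))
... | no  _    | no  _      | no  _   = occ+countAbove r b

psum-content+countAbove : ∀ {b} → Positive b → ∀ r → psum (content b) r + countAbove r b ≡ length b
psum-content+countAbove b⁺ zero = countAbove-zero b⁺
psum-content+countAbove {b} b⁺ (suc r) = begin
  psum (content b) r + occ (suc r) b + countAbove (suc r) b  ≡⟨ +-assoc (psum (content b) r) _ _ ⟩
  psum (content b) r + (occ (suc r) b + countAbove (suc r) b) ≡⟨ cong (psum (content b) r +_) (occ+countAbove r b) ⟩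
  psum (content b) r + countAbove r b                        ≡⟨ psum-content+countAbove b⁺ r ⟩
  length b                                                   ∎
  where open ≡-Reasoning

-- Lattice permutations

LatticePerm-[] : LatticePerm []
LatticePerm-[] .0 a b z≤n _ _ = z≤n

LatticePerm-++⁻ˡ : ∀ p {q} → LatticePerm (p ++ q) → LatticePerm p
LatticePerm-++⁻ˡ p {q} L k a b k≤p 1≤a a<b =
  subst (λ t → occ b t ≤ occ a t) (take-++-≤ k p q k≤p) (L k a b (≤-trans k≤p (length-++-≤ˡ p)) 1≤a a<b)

LatticePerm⇒occ-anti : ∀ {p a b} → LatticePerm p → 1 ≤ a → a ≤ b → occ b p ≤ occ a p
LatticePerm⇒occ-anti {p} {a} {b} L 1≤a a≤b with m≤n⇒m<n∨m≡n a≤b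
... | inj₂ refl = ≤-refl
... | inj₁ a<b  = subst (λ t → occ b t ≤ occ a t) (take-all (length p) p ≤-refl) (L (length p) a b ≤-refl 1≤a a<b)

Descent : List ℕ → ℕ → Set
Descent p w = occ w p < occ (pred w) p

data Appendable (p : List ℕ) : ℕ → Set where
  one     : Appendable p 1
  descent : ∀ {w} → Descent p w → Appendable p w

appendable? : ∀ p w → Dec (Appendable p w)
appendable? p w with w ≟ 1 | occ w p <? occ (pred w) p
... | yes refl | _         = yes one
... | no  _    | yes desc  = yes (descent desc)
... | no  w≢1  | no  ¬desc = no λ { one → w≢1 refl ; (descent desc) → ¬desc desc }

Appendable⇒pos : ∀ {p w} → Appendable p w → 1 ≤ w
Appendable⇒pos {w = suc w} _ = s≤s z≤n
Appendable⇒pos {w = zero} (descent desc) = ⊥-elim (<-irrefl refl desc)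

LatticePerm-∷ʳ⁻ : ∀ p {x} → LatticePerm (p ++ [ x ]) → 1 ≤ x → Appendable p x
LatticePerm-∷ʳ⁻ p {suc zero}    _ _ = one
LatticePerm-∷ʳ⁻ p {suc (suc y)} L _ = descent (begin-strict
  occ (2 + y) p                   <⟨ n<1+n _ ⟩
  suc (occ (2 + y) p)             ≡⟨ occ-∷ʳ-≡ (2 + y) p ⟨
  occ (2 + y) (p ++ [ 2 + y ])    ≤⟨ LatticePerm⇒occ-anti L (s≤s z≤n) (n≤1+n (suc y)) ⟩
  occ (1 + y) (p ++ [ 2 + y ])    ≡⟨ occ-∷ʳ-≢ p (λ ()) ⟩
  occ (1 + y) p                   ∎)
  where open ≤-Reasoning

LatticePerm-∷ʳ⁺ : ∀ {p x} → LatticePerm p → Appendable p x → LatticePerm (p ++ [ x ])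
LatticePerm-∷ʳ⁺ {p} {x} L app k a b k≤ 1≤a a<b with k ≤? length p
... | yes k≤p = subst (λ t → occ b t ≤ occ a t) (sym (take-++-≤ k p [ x ] k≤p)) (L k a b k≤p 1≤a a<b)
... | no  k≰p = subst (λ t → occ b t ≤ occ a t) (sym (take-all k (p ++ [ x ]) p+1≤k)) (full (b ≟ x) app)
  where
  p+1≤k : length (p ++ [ x ]) ≤ k
  p+1≤k = subst (_≤ k) (sym (trans (length-++ p) (+-comm (length p) 1))) (≰⇒> k≰p)
  full : Dec (b ≡ x) → Appendable p x → occ b (p ++ [ x ]) ≤ occ a (p ++ [ x ])
  full (yes refl) one          = ⊥-elim (<⇒≱ a<b 1≤a)
  full (yes refl) (descent desc) = begin
    occ b (p ++ [ b ])  ≡⟨ occ-∷ʳ-≡ b p ⟩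
    suc (occ b p)       ≤⟨ desc ⟩
    occ (pred b) p      ≤⟨ LatticePerm⇒occ-anti L 1≤a (<⇒≤pred a<b) ⟩
    occ a p             ≤⟨ occ-≤-++ a p [ b ] ⟩
    occ a (p ++ [ b ])  ∎
    where open ≤-Reasoning
  full (no b≢x) _ = begin
    occ b (p ++ [ x ])  ≡⟨ occ-∷ʳ-≢ p (b≢x ∘ sym) ⟩
    occ b p             ≤⟨ LatticePerm⇒occ-anti L 1≤a (<⇒≤ a<b) ⟩
    occ a p             ≤⟨ occ-≤-++ a p [ x ] ⟩
    occ a (p ++ [ x ])  ∎
    where open ≤-Reasoning

maxEntry : List ℕ → ℕ
maxEntry = foldr _⊔_ 0

-- bounds every value appendable to p without occurring in p: the greedy bound at the start of a block
fresh : List ℕ → ℕ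
fresh p = suc (maxEntry p)

occ-pos⇒≤maxEntry : ∀ a p → 0 < occ a p → a ≤ maxEntry p
occ-pos⇒≤maxEntry a (x ∷ p) pos with x ≟ a
... | yes refl = m≤m⊔n x (maxEntry p)
... | no  _    = ≤-trans (occ-pos⇒≤maxEntry a p pos) (m≤n⊔m x (maxEntry p))

occ->maxEntry : ∀ {a} p → maxEntry p < a → occ a p ≡ 0
occ->maxEntry {a} p max<a = n≤0⇒n≡0 (≮⇒≥ (λ pos → <⇒≱ max<a (occ-pos⇒≤maxEntry a p pos)))

Appendable⇒≤fresh : ∀ {p w} → Appendable p w → w ≤ fresh p
Appendable⇒≤fresh             one                = s≤s z≤n
Appendable⇒≤fresh {p} {suc w} (descent desc)     = s≤s (occ-pos⇒≤maxEntry w p (≤-<-trans z≤n desc))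
Appendable⇒≤fresh {w = zero}  (descent desc)     = ⊥-elim (<-irrefl refl desc)

descent-between : ∀ Q {r u} → r < u → occ u Q < occ r Q → Σ ℕ λ w → r < w × w ≤ u × Descent Q w
descent-between Q {r} {suc u} r<u occ-lt with occ (suc u) Q <? occ u Q
... | yes desc  = suc u , r<u , ≤-refl , desc
... | no  ¬desc with m≤n⇒m<n∨m≡n (≤-pred r<u)
...   | inj₂ refl = ⊥-elim (¬desc occ-lt)
...   | inj₁ r<u′ with descent-between Q r<u′ (≤-<-trans (≮⇒≥ ¬desc) occ-lt)
...     | w , r<w , w≤u , desc = w , r<w , m≤n⇒m≤1+n w≤u , desc

no-descent⇒occ-≤ : ∀ Q {x u} → x ≤ u → (∀ w → x < w → w ≤ u → ¬ Descent Q w) → occ x Q ≤ occ u Q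
no-descent⇒occ-≤ Q x≤u none with m≤n⇒m<n∨m≡n x≤u
... | inj₂ refl = ≤-refl
... | inj₁ x<u  = ≮⇒≥ λ occ-lt → let (w , x<w , w≤u , desc) = descent-between Q x<u occ-lt in none w x<w w≤u desc

-- Greedy blocks

Largest≤ : (ℕ → Set) → ℕ → ℕ → Set
Largest≤ P u x = x ≤ u × P x × (∀ w → w ≤ u → P w → w ≤ x)

largest≤ : ∀ {P : ℕ → Set} → (∀ w → Dec (P w)) → ∀ {m} u → m ≤ u → P m → Σ ℕ (Largest≤ P u)
largest≤ P? zero    z≤n pm = zero , z≤n , pm , λ { _ z≤n _ → z≤n }
largest≤ {P} P? (suc u) m≤u pm with P? (suc u)
... | yes pu = suc u , ≤-refl , pu , λ w w≤u _ → w≤u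
... | no ¬pu with m≤n⇒m<n∨m≡n m≤u
...   | inj₂ refl = ⊥-elim (¬pu pm)
...   | inj₁ m<u with largest≤ P? u (≤-pred m<u) pm
...     | x , x≤u , px , max = x , m≤n⇒m≤1+n x≤u , px , max′
  where
  max′ : ∀ w → w ≤ suc u → P w → w ≤ x
  max′ w w≤u pw with m≤n⇒m<n∨m≡n w≤u
  ... | inj₁ w<u  = max w (≤-pred w<u) pw
  ... | inj₂ refl = ⊥-elim (¬pu pw)

GreedyBlock : List ℕ → ℕ → List ℕ → Set
GreedyBlock Q u []      = ⊤
GreedyBlock Q u (x ∷ c) = Largest≤ (Appendable Q) u x × GreedyBlock (Q ++ [ x ]) x c

-- While r is still more frequent than the current bound u, some value in (r, u] is a
-- descent, so the greedy choice stays above r and its frequency grows by one per step.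
greedyBlock-countAbove : ∀ {r} c {Q u} j → r < u → occ u Q ≤ j → GreedyBlock Q u c → LatticePerm Q →
  length c ⊓ (occ r Q ∸ j) ≤ countAbove r c
greedyBlock-countAbove [] j _ _ _ _ = z≤n
greedyBlock-countAbove {r} (x ∷ c) {Q} {u} j r<u occu≤j ((x≤u , appx , maxx) , greedy) L with occ r Q ≤? j
... | yes occr≤j = subst (λ t → suc (length c) ⊓ t ≤ countAbove r (x ∷ c)) (sym (m≤n⇒m∸n≡0 occr≤j)) z≤n
... | no  occr≰j = begin
  suc (length c) ⊓ (occ r Q ∸ j)               ≡⟨ cong (suc (length c) ⊓_) (+-∸-assoc 1 j<occr) ⟩
  suc (length c ⊓ (occ r Q ∸ suc j))           ≡⟨ cong (λ t → suc (length c ⊓ (t ∸ suc j))) occr-unchanged ⟨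
  suc (length c ⊓ (occ r (Q ++ [ x ]) ∸ suc j)) ≤⟨ s≤s (greedyBlock-countAbove c (suc j) r<x occx≤ greedy L′) ⟩
  suc (countAbove r c)                          ≡⟨ countAbove-∷-> c r<x ⟨
  countAbove r (x ∷ c)                          ∎
  where
  open ≤-Reasoning
  j<occr : j < occ r Q
  j<occr = ≰⇒> occr≰j
  r<x : r < x
  r<x with descent-between Q r<u (≤-<-trans occu≤j j<occr)
  ... | w , r<w , w≤u , desc = <-≤-trans r<w (maxx w w≤u (descent desc))
  occr-unchanged : occ r (Q ++ [ x ]) ≡ occ r Q
  occr-unchanged = occ-∷ʳ-≢ Q (<⇒≢ r<x ∘ sym)
  L′ : LatticePerm (Q ++ [ x ])
  L′ = LatticePerm-∷ʳ⁺ L appx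
  occx≤ : occ x (Q ++ [ x ]) ≤ suc j
  occx≤ = subst (_≤ suc j) (sym (occ-∷ʳ-≡ x Q)) (s≤s (≤-trans
    (no-descent⇒occ-≤ Q x≤u (λ w x<w w≤u desc → <⇒≱ x<w (maxx w w≤u (descent desc)))) occu≤j))

greedyBlock-countAbove-fresh : ∀ r c {Q} → GreedyBlock Q (fresh Q) c → LatticePerm Q →
  length c ⊓ occ r Q ≤ countAbove r c
greedyBlock-countAbove-fresh r c {Q} greedy L with r <? fresh Q
... | yes r<fresh = greedyBlock-countAbove c 0 r<fresh (≤-reflexive (occ->maxEntry Q ≤-refl)) greedy L
... | no  r≮fresh = subst (λ t → length c ⊓ t ≤ countAbove r c)
                      (sym (occ->maxEntry Q (≮⇒≥ r≮fresh))) (≤-trans (≤-reflexive (⊓-zeroʳ (length c))) z≤n)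

-- In a nonincreasing block appended to a lattice permutation, each entry above r
-- consumes one of the earlier occurrences of r.
countAbove-block : ∀ {r v} b {Q} → 1 ≤ r → r < v → Nonincreasing (v ∷ b) → LatticePerm (Q ++ b) →
  countAbove r b + occ v Q ≤ occ r Q
countAbove-block [] {Q} 1≤r r<v _ L =
  LatticePerm⇒occ-anti (subst LatticePerm (++-identityʳ Q) L) 1≤r (<⇒≤ r<v)
countAbove-block {r} {v} (x ∷ b) {Q} 1≤r r<v (x≤v ∷ b↘) L with x ≤? r
... | yes x≤r = subst (λ t → t + occ v Q ≤ occ r Q) (sym (countAbove-↘ b b↘ x≤r))
                  (LatticePerm⇒occ-anti (LatticePerm-++⁻ˡ Q L) 1≤r (<⇒≤ r<v))
... | no  x≰r = begin
  countAbove r (x ∷ b) + occ v Q          ≡⟨ cong (_+ occ v Q) (countAbove-∷-> b r<x) ⟩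
  suc (countAbove r b) + occ v Q          ≡⟨ +-suc (countAbove r b) (occ v Q) ⟨
  countAbove r b + suc (occ v Q)          ≤⟨ +-monoʳ-≤ (countAbove r b) (s≤s occv≤occx) ⟩
  countAbove r b + suc (occ x Q)          ≡⟨ cong (countAbove r b +_) (occ-∷ʳ-≡ x Q) ⟨
  countAbove r b + occ x (Q ++ [ x ])      ≤⟨ countAbove-block b 1≤r r<x b↘ L′ ⟩
  occ r (Q ++ [ x ])                       ≡⟨ occ-∷ʳ-≢ Q (<⇒≢ r<x ∘ sym) ⟩
  occ r Q                                  ∎
  where
  open ≤-Reasoning
  L′ : LatticePerm ((Q ++ [ x ]) ++ b)
  L′ = subst LatticePerm (sym (++-assoc Q [ x ] b)) L
  LQ : LatticePerm Q
  LQ = LatticePerm-++⁻ˡ Q L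
  r<x : r < x
  r<x = ≰⇒> x≰r
  occv≤occx : occ v Q ≤ occ x Q
  occv≤occx = LatticePerm⇒occ-anti LQ (≤-trans 1≤r (<⇒≤ r<x)) x≤v

countAbove-≤-occ : ∀ {r} b {Q} → 1 ≤ r → Nonincreasing b → LatticePerm (Q ++ b) → countAbove r b ≤ occ r Q
countAbove-≤-occ []      _   _  _ = z≤n
countAbove-≤-occ {r} (x ∷ b) 1≤r b↘ L with x ≤? r
... | yes x≤r = ≤-trans (≤-reflexive (countAbove-↘ b b↘ x≤r)) z≤n
... | no  x≰r =
  ≤-trans (m≤m+n (countAbove r (x ∷ b)) _) (countAbove-block (x ∷ b) 1≤r (≰⇒> x≰r) (≤-refl ∷ b↘) L)

psum-content-≤-++ : ∀ P b r → psum (content P) r ≤ psum (content (P ++ b)) r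
psum-content-≤-++ P b r = subst (psum (content P) r ≤_) (sym (psum-content-++ P b r)) (m≤m+n _ _)

psum≡sum-take⇒content≡entry : ∀ P {S} → (∀ r → psum (content P) r ≡ sum (take r S)) →
  ∀ r → content P (suc r) ≡ entry S (suc r)
psum≡sum-take⇒content≡entry P {S} eq r = +-cancelˡ-≡ (psum (content P) r) _ _ (begin
  psum (content P) r + content P (suc r)  ≡⟨ eq (suc r) ⟩
  sum (take (suc r) S)                    ≡⟨ sum-take-suc r S ⟩
  sum (take r S) + entry S (suc r)        ≡⟨ cong (_+ entry S (suc r)) (eq r) ⟨
  psum (content P) r + entry S (suc r)    ∎)
  where open ≡-Reasoning

+-≤-⊔ : ∀ m n x t → x + t ≡ n → n ⊓ m ≤ t → m + x ≤ m ⊔ n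
+-≤-⊔ m n x t x+t≡n n⊓m≤t with ≤-total m n
... | inj₁ m≤n = begin
  m + x   ≤⟨ +-monoˡ-≤ x (subst (_≤ t) (m≥n⇒m⊓n≡n m≤n) n⊓m≤t) ⟩
  t + x   ≡⟨ trans (+-comm t x) x+t≡n ⟩
  n       ≡⟨ m≤n⇒m⊔n≡n m≤n ⟨
  m ⊔ n   ∎
  where open ≤-Reasoning
... | inj₂ n≤m = begin
  m + x   ≡⟨ cong (m +_) x≡0 ⟩
  m + 0   ≡⟨ +-identityʳ m ⟩
  m       ≡⟨ m≥n⇒m⊔n≡m n≤m ⟨
  m ⊔ n   ∎
  where
  open ≤-Reasoning
  x≡0 : x ≡ 0
  x≡0 = n≤0⇒n≡0 (+-cancelʳ-≤ t x 0
    (≤-trans (≤-reflexive x+t≡n) (subst (_≤ t) (m≤n⇒m⊓n≡m n≤m) n⊓m≤t)))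

-- If d becomes one of the r+1 largest parts, b pays for it: by the lattice condition at most
-- occ (r+1) P entries of b exceed r+1.
sum-take-insert-≤-psum : ∀ {d S P b} → Nonincreasing S → Nonincreasing b → Positive b → length b ≡ d →
  LatticePerm (P ++ b) → (∀ r → sum (take r S) ≤ psum (content P) r) →
  ∀ r → sum (take r (insert d S)) ≤ psum (content (P ++ b)) r
sum-take-insert-≤-psum _ _ _ _ _ _ zero = z≤n
sum-take-insert-≤-psum {d} {S} {P} {b} S↘ b↘ b⁺ |b|≡d L below (suc r) = begin
  sum (take (suc r) (insert d S))                             ≡⟨ sum-take-insert r d S S↘ ⟩
  sum (take r S) + (entry S (suc r) ⊔ d)                      ≡⟨ +-distribˡ-⊔ (sum (take r S)) _ _ ⟩
  (sum (take r S) + entry S (suc r)) ⊔ (sum (take r S) + d)   ≤⟨ ⊔-lub old new ⟩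
  psum (content (P ++ b)) (suc r)                             ∎
  where
  open ≤-Reasoning
  old : sum (take r S) + entry S (suc r) ≤ psum (content (P ++ b)) (suc r)
  old = ≤-trans (≤-reflexive (sym (sum-take-suc r S))) (≤-trans (below (suc r)) (psum-content-≤-++ P b (suc r)))
  new : sum (take r S) + d ≤ psum (content (P ++ b)) (suc r)
  new = begin
    sum (take r S) + d                                                  ≤⟨ +-monoˡ-≤ d (below r) ⟩
    psum (content P) r + d                                              ≡⟨ cong (psum (content P) r +_) (trans (sym |b|≡d)
                                                                             (sym (psum-content+countAbove b⁺ (suc r)))) ⟩
    psum (content P) r + (psum (content b) (suc r) + countAbove (suc r) b) ≤⟨ +-monoʳ-≤ (psum (content P) r)
                                                                             (+-monoʳ-≤ (psum (content b) (suc r))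
                                                                               (countAbove-≤-occ b (s≤s z≤n) b↘ L)) ⟩
    psum (content P) r + (psum (content b) (suc r) + occ (suc r) P)     ≡⟨ cong (psum (content P) r +_) (+-comm _ (occ (suc r) P)) ⟩
    psum (content P) r + (occ (suc r) P + psum (content b) (suc r))     ≡⟨ +-assoc (psum (content P) r) _ _ ⟨
    psum (content P) (suc r) + psum (content b) (suc r)                 ≡⟨ psum-content-++ P b (suc r) ⟨
    psum (content (P ++ b)) (suc r)                                     ∎

psum-≤-sum-take-insert : ∀ {d S P b} → Nonincreasing S → Positive b → length b ≡ d →
  GreedyBlock P (fresh P) b → LatticePerm P → (∀ r → psum (content P) r ≡ sum (take r S)) →
  ∀ r → psum (content (P ++ b)) r ≤ sum (take r (insert d S))
psum-≤-sum-take-insert _ _ _ _ _ _ zero = z≤n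
psum-≤-sum-take-insert {d} {S} {P} {b} S↘ b⁺ |b|≡d greedy L eq (suc r) = begin
  psum (content (P ++ b)) (suc r)                                        ≡⟨ psum-content-++ P b (suc r) ⟩
  psum (content P) r + occ (suc r) P + psum (content b) (suc r)          ≡⟨ cong₂ (λ s e → s + e + psum (content b) (suc r))
                                                                              (eq r) occ≡entry ⟩
  sum (take r S) + entry S (suc r) + psum (content b) (suc r)            ≡⟨ +-assoc (sum (take r S)) _ _ ⟩
  sum (take r S) + (entry S (suc r) + psum (content b) (suc r))          ≤⟨ +-monoʳ-≤ (sum (take r S))
                                                                              (+-≤-⊔ _ d _ _ b-splits many-above) ⟩
  sum (take r S) + (entry S (suc r) ⊔ d)                                 ≡⟨ sum-take-insert r d S S↘ ⟨
  sum (take (suc r) (insert d S))                                        ∎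
  where
  open ≤-Reasoning
  occ≡entry : occ (suc r) P ≡ entry S (suc r)
  occ≡entry = psum≡sum-take⇒content≡entry P eq r
  b-splits : psum (content b) (suc r) + countAbove (suc r) b ≡ d
  b-splits = trans (psum-content+countAbove b⁺ (suc r)) |b|≡d
  many-above : d ⊓ entry S (suc r) ≤ countAbove (suc r) b
  many-above = subst₂ (λ l e → l ⊓ e ≤ countAbove (suc r) b) |b|≡d occ≡entry
    (greedyBlock-countAbove-fresh (suc r) b greedy L)

sum-take-insertAll-≤-psum : ∀ δ′ {P ω S} → Nonincreasing S → All Nonincreasing (blocks δ′ ω) → Positive ω →
  length ω ≡ sum δ′ → LatticePerm (P ++ ω) → (∀ r → sum (take r S) ≤ psum (content P) r) →
  ∀ r → sum (take r (insertAll δ′ S)) ≤ psum (content (P ++ ω)) r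
sum-take-insertAll-≤-psum [] {P} {[]} _ _ _ _ _ below r =
  subst (λ Q → _ ≤ psum (content Q) r) (sym (++-identityʳ P)) (below r)
sum-take-insertAll-≤-psum (d ∷ δ′) {P} {ω} {S} S↘ (b↘ ∷ blocks↘) ω⁺ |ω|≡ L below r =
  subst (λ Q → _ ≤ psum (content Q) r) (++-take++drop P d ω)
    (sum-take-insertAll-≤-psum δ′ (Insertion.insert-↗ d S↘) blocks↘ (Allₚ.drop⁺ d ω⁺) (length-drop-≡ ω |ω|≡) L′ step r)
  where
  L′ : LatticePerm ((P ++ take d ω) ++ drop d ω)
  L′ = subst LatticePerm (sym (++-take++drop P d ω)) L
  step : ∀ r → sum (take r (insert d S)) ≤ psum (content (P ++ take d ω)) r
  step = sum-take-insert-≤-psum S↘ b↘ (Allₚ.take⁺ d ω⁺) (length-take-≡ ω |ω|≡)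
           (LatticePerm-++⁻ˡ (P ++ take d ω) L′) below

-- Blocks of a composition

blocks-++ : ∀ δ₁ {δ₂} D {Y} → length D ≡ sum δ₁ → blocks (δ₁ ++ δ₂) (D ++ Y) ≡ blocks δ₁ D ++ blocks δ₂ Y
blocks-++ []       []      _      = refl
blocks-++ (d ∷ δ₁) {δ₂} D {Y} |D|≡ =
  cong₂ _∷_ (take-++-≤ d D Y d≤|D|)
    (trans (cong (blocks (δ₁ ++ δ₂)) (drop-++-≤ d D Y d≤|D|)) (blocks-++ δ₁ (drop d D) (length-drop-≡ D |D|≡)))
  where
  d≤|D| : d ≤ length D
  d≤|D| = subst (d ≤_) (sym |D|≡) (m≤m+n d (sum δ₁))

blocks-∷ : ∀ {d} δ c {m} R → length c + m ≡ d → blocks (d ∷ δ) (c ++ R) ≡ (c ++ take m R) ∷ blocks δ (drop m R)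
blocks-∷ δ c R refl = cong₂ (λ t u → t ∷ blocks δ u) (take-++-+ c _ R) (drop-++-+ c _ R)

Ones : List ℕ → Set
Ones = All (_≡ 1)

ones-↘ : ∀ {R} → Ones R → Nonincreasing R
ones-↘ []                 = []
ones-↘ (refl ∷ [])        = [-]
ones-↘ (refl ∷ refl ∷ os) = ≤-refl ∷ ones-↘ (refl ∷ os)

↘-++-ones : ∀ {xs R} → Positive xs → Nonincreasing xs → Ones R → Nonincreasing (xs ++ R)
↘-++-ones []             []          os          = ones-↘ os
↘-++-ones (_   ∷ [])     [-]         []          = [-]
↘-++-ones (1≤x ∷ [])     [-]         (refl ∷ os) = 1≤x ∷ ones-↘ (refl ∷ os)
↘-++-ones (_   ∷ xs⁺)    (y≤x ∷ xs↘) os          = y≤x ∷ ↘-++-ones xs⁺ xs↘ os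

blocks-ones-↘ : ∀ δ {R} → Ones R → All Nonincreasing (blocks δ R)
blocks-ones-↘ []      os = []
blocks-ones-↘ (d ∷ δ) os = ones-↘ (Allₚ.take⁺ d os) ∷ blocks-ones-↘ δ (Allₚ.drop⁺ d os)

↘-++⁻ˡ : ∀ xs {ys} → Nonincreasing (xs ++ ys) → Nonincreasing xs
↘-++⁻ˡ []           _            = []
↘-++⁻ˡ (x ∷ [])     _            = [-]
↘-++⁻ˡ (x ∷ y ∷ xs) (y≤x ∷ xs↘)  = y≤x ∷ ↘-++⁻ˡ (y ∷ xs) xs↘

lastOr : ℕ → List ℕ → ℕ
lastOr u []      = u
lastOr u (x ∷ q) = lastOr x q

lastOr-∷ʳ : ∀ u q x → lastOr u (q ++ [ x ]) ≡ x
lastOr-∷ʳ u []      x = refl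
lastOr-∷ʳ u (y ∷ q) x = lastOr-∷ʳ y q x

∷ʳ-↘⇒≤lastOr : ∀ {u} q {w} → Nonincreasing (q ++ [ w ]) → w ≤ u → w ≤ lastOr u q
∷ʳ-↘⇒≤lastOr []      _ w≤u = w≤u
∷ʳ-↘⇒≤lastOr (x ∷ q) ↘ _   = go x q ↘
  where
  go : ∀ x q {w} → Nonincreasing (x ∷ q ++ [ w ]) → w ≤ lastOr x q
  go x []      (w≤x ∷ _) = w≤x
  go x (y ∷ q) (_ ∷ ↘)   = go y q ↘

≤lastOr⇒∷ʳ-↘ : ∀ {u} q {w} → Nonincreasing q → w ≤ lastOr u q → Nonincreasing (q ++ [ w ])
≤lastOr⇒∷ʳ-↘ []          _           _   = [-]
≤lastOr⇒∷ʳ-↘ (x ∷ [])    [-]         w≤x = w≤x ∷ [-]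
≤lastOr⇒∷ʳ-↘ (x ∷ y ∷ q) (y≤x ∷ q↘)  w≤  = y≤x ∷ ≤lastOr⇒∷ʳ-↘ {u = x} (y ∷ q) q↘ w≤

lastOr-pos : ∀ {u} q → 1 ≤ u → Positive q → 1 ≤ lastOr u q
lastOr-pos []      1≤u _           = 1≤u
lastOr-pos (x ∷ q) _   (1≤x ∷ q⁺) = lastOr-pos q 1≤x q⁺

DeltaNonincreasing-full : ∀ {n δ ω} → length ω ≡ n → DeltaNonincreasing n δ ω → All Nonincreasing (blocks δ ω)
DeltaNonincreasing-full {n} {δ} {ω} refl (_ , padded↘) =
  subst (λ ω′ → All Nonincreasing (blocks δ ω′))
    (trans (cong (λ k → ω ++ replicate k 1) (n∸n≡0 n)) (++-identityʳ ω)) padded↘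

-- The minimal sequence

module Greedy (n : ℕ) (δ : List ℕ) where

  IsGreedyNext : List ℕ → ℕ → Set
  IsGreedyNext P x = 1 ≤ x × Admissible n δ (P ++ [ x ]) × (∀ w → 1 ≤ w → Admissible n δ (P ++ [ w ]) → w ≤ x)

  GreedyRun : List ℕ → List ℕ → Set
  GreedyRun P []         = ⊤
  GreedyRun P (x ∷ rest) = IsGreedyNext P x × GreedyRun (P ++ [ x ]) rest

  minimal⇒greedyRun : ∀ {ω̂} → IsMinimalSeq n δ ω̂ → GreedyRun [] ω̂
  minimal⇒greedyRun {ω̂} (|ω̂|≡n , _ , greedyAt) = go n 0 refl
    where
    go : ∀ k i → i + k ≡ n → GreedyRun (take i ω̂) (drop i ω̂)
    go zero    i i+0≡n = subst (GreedyRun (take i ω̂)) (sym (drop-all i ω̂ (≤-reflexive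
                           (trans |ω̂|≡n (trans (sym i+0≡n) (+-identityʳ i)))))) tt
    go (suc k) i i+k≡n with greedyAt i (subst (i <_) i+k≡n (m<m+n i (s≤s z≤n)))
    ... | v , take≡ , 1≤v , adm , max = subst (GreedyRun (take i ω̂)) (sym (drop≡∷ i ω̂ take≡))
          ((1≤v , adm , max) ,
           subst (λ P → GreedyRun P (drop (suc i) ω̂)) take≡ (go k (suc i) (trans (sym (+-suc i k)) i+k≡n)))

  greedyRun-at : ∀ P {rest} → GreedyRun P rest → ∀ i → i < length rest → Σ ℕ λ v →
    take (suc i) rest ≡ take i rest ++ [ v ] × IsGreedyNext (P ++ take i rest) v
  greedyRun-at P {x ∷ rest} (next , _) zero _ = x , refl , subst (λ Q → IsGreedyNext Q x) (sym (++-identityʳ P)) next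
  greedyRun-at P {x ∷ rest} (_ , run) (suc i) (s≤s i<) with greedyRun-at (P ++ [ x ]) run i i<
  ... | v , take≡ , next = v , cong (x ∷_) take≡ , subst (λ Q → IsGreedyNext Q v) (++-assoc P [ x ] (take i rest)) next

  greedyRun⇒minimal : ∀ {ω̂} → GreedyRun [] ω̂ → length ω̂ ≡ n → IsMinimalSeq n δ ω̂
  greedyRun⇒minimal {ω̂} run |ω̂|≡n =
    |ω̂|≡n , starts-with-1 ω̂ run |ω̂|≡n , λ i i<n → greedyRun-at [] run i (subst (i <_) (sym |ω̂|≡n) i<n)
    where
    starts-with-1 : ∀ ω̂ → GreedyRun [] ω̂ → length ω̂ ≡ n → take 1 ω̂ ≡ take n [ 1 ]
    starts-with-1 []      _                           refl = refl
    starts-with-1 (x ∷ r) ((1≤x , (_ , L , _) , _) , _) refl with LatticePerm-∷ʳ⁻ [] L 1≤x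
    ... | one            = cong (1 ∷_) (sym (take-[] (length r)))
    ... | descent ()

module _ {n : ℕ} {δ : List ℕ} (n≡Σδ : n ≡ sum δ) where

  open Greedy n δ

  -- Q = D ++ q, where D fills the parts δ₁ exactly and q is an initial segment of the next part
  record Cursor (δ₁ δ₂ D Q q : List ℕ) : Set where
    field
      parts    : δ ≡ δ₁ ++ δ₂
      filled   : length D ≡ sum δ₁
      split    : Q ≡ D ++ q
      blocks↘  : All Nonincreasing (blocks δ₁ D)
      q↘       : Nonincreasing q
      positive : Positive Q
      lattice  : LatticePerm Q

  open Cursor

  cursor-start : Cursor [] δ [] [] []
  cursor-start = record
    { parts = refl ; filled = refl ; split = refl ; blocks↘ = [] ; q↘ = [] ; positive = [] ; lattice = LatticePerm-[] }

  cursor-∷ʳ : ∀ {δ₁ δ₂ D Q q x} → Cursor δ₁ δ₂ D Q q → Appendable Q x → Nonincreasing (q ++ [ x ]) →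
    Cursor δ₁ δ₂ D (Q ++ [ x ]) (q ++ [ x ])
  cursor-∷ʳ {D = D} {q = q} {x} cur app ↘ = record
    { parts    = parts cur
    ; filled   = filled cur
    ; split    = trans (cong (_++ [ x ]) (split cur)) (++-assoc D q [ x ])
    ; blocks↘  = blocks↘ cur
    ; q↘       = ↘
    ; positive = Allₚ.++⁺ (positive cur) (Appendable⇒pos app ∷ [])
    ; lattice  = LatticePerm-∷ʳ⁺ (lattice cur) app
    }

  cursor-next : ∀ {δ₁ d δ₂ D Q q} → Cursor δ₁ (d ∷ δ₂) D Q q → length q ≡ d →
    Cursor (δ₁ ++ [ d ]) δ₂ Q Q []
  cursor-next {δ₁} {d} {δ₂} {D} {Q} {q} cur |q|≡d = record
    { parts    = trans (parts cur) (sym (++-assoc δ₁ [ d ] δ₂))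
    ; filled   = begin
        length Q              ≡⟨ cong length (split cur) ⟩
        length (D ++ q)       ≡⟨ length-++ D ⟩
        length D + length q   ≡⟨ cong₂ _+_ (filled cur) (trans |q|≡d (sym (+-identityʳ d))) ⟩
        sum δ₁ + sum [ d ]    ≡⟨ sum-++ δ₁ [ d ] ⟨
        sum (δ₁ ++ [ d ])     ∎
    ; split    = sym (++-identityʳ Q)
    ; blocks↘  = subst (All Nonincreasing) (sym blocks≡) (Allₚ.++⁺ (blocks↘ cur) (take↘ ∷ []))
    ; q↘       = []
    ; positive = positive cur
    ; lattice  = lattice cur
    }
    where
    open ≡-Reasoning
    take↘ : Nonincreasing (take d q)
    take↘ = subst Nonincreasing (sym (take-all d q (≤-reflexive |q|≡d))) (q↘ cur)
    blocks≡ : blocks (δ₁ ++ [ d ]) Q ≡ blocks δ₁ D ++ [ take d q ]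
    blocks≡ = trans (cong (blocks (δ₁ ++ [ d ])) (split cur)) (blocks-++ δ₁ D (filled cur))

  module _ {δ₁ d δ₂ D Q q} (cur : Cursor δ₁ (d ∷ δ₂) D Q q) (|q|<d : length q < d) where

    private
      m : ℕ
      m = d ∸ suc (length q)

      Q++w≡ : ∀ w → Q ++ [ w ] ≡ D ++ (q ++ [ w ])
      Q++w≡ w = trans (cong (_++ [ w ]) (split cur)) (++-assoc D q [ w ])

      |q++w|+m≡d : ∀ w → length (q ++ [ w ]) + m ≡ d
      |q++w|+m≡d w = trans (cong (_+ m) (trans (length-++ q) (+-comm (length q) 1))) (m+[n∸m]≡n |q|<d)

      blocks-padded : ∀ w R →
        blocks δ ((Q ++ [ w ]) ++ R) ≡ blocks δ₁ D ++ ((q ++ [ w ]) ++ take m R) ∷ blocks δ₂ (drop m R)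
      blocks-padded w R = begin
        blocks δ ((Q ++ [ w ]) ++ R)                       ≡⟨ cong₂ blocks (parts cur) (trans (cong (_++ R) (Q++w≡ w))
                                                                (++-assoc D (q ++ [ w ]) R)) ⟩
        blocks (δ₁ ++ d ∷ δ₂) (D ++ ((q ++ [ w ]) ++ R))   ≡⟨ blocks-++ δ₁ D (filled cur) ⟩
        blocks δ₁ D ++ blocks (d ∷ δ₂) ((q ++ [ w ]) ++ R) ≡⟨ cong (blocks δ₁ D ++_) (blocks-∷ δ₂ (q ++ [ w ]) R (|q++w|+m≡d w)) ⟩
        blocks δ₁ D ++ ((q ++ [ w ]) ++ take m R) ∷ blocks δ₂ (drop m R) ∎
        where open ≡-Reasoning

      |Q++w|≤n : ∀ w → length (Q ++ [ w ]) ≤ n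
      |Q++w|≤n w = begin
        length (Q ++ [ w ])               ≡⟨ cong length (Q++w≡ w) ⟩
        length (D ++ (q ++ [ w ]))        ≡⟨ length-++ D ⟩
        length D + length (q ++ [ w ])    ≡⟨ cong (_+ length (q ++ [ w ])) (filled cur) ⟩
        sum δ₁ + length (q ++ [ w ])      ≤⟨ +-monoʳ-≤ (sum δ₁) (≤-trans (m≤m+n _ m) (≤-reflexive (|q++w|+m≡d w))) ⟩
        sum δ₁ + d                        ≤⟨ +-monoʳ-≤ (sum δ₁) (m≤m+n d (sum δ₂)) ⟩
        sum δ₁ + sum (d ∷ δ₂)             ≡⟨ sum-++ δ₁ (d ∷ δ₂) ⟨
        sum (δ₁ ++ d ∷ δ₂)                ≡⟨ cong sum (parts cur) ⟨
        sum δ                             ≡⟨ n≡Σδ ⟨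
        n                                 ∎
        where open ≤-Reasoning

    admissible-∷ʳ⁻ : ∀ {w} → Admissible n δ (Q ++ [ w ]) → Appendable Q w × Nonincreasing (q ++ [ w ])
    admissible-∷ʳ⁻ {w} (Q++w⁺ , L , _ , padded↘)
      with Allₚ.++⁻ʳ (blocks δ₁ D) (subst (All Nonincreasing) (blocks-padded w _) padded↘)
    ... | block↘ ∷ _ = LatticePerm-∷ʳ⁻ Q L 1≤w , ↘-++⁻ˡ (q ++ [ w ]) block↘
      where
      1≤w : 1 ≤ w
      1≤w with Allₚ.++⁻ʳ Q Q++w⁺
      ... | 1≤w ∷ [] = 1≤w

    admissible-∷ʳ⁺ : ∀ {w} → Appendable Q w → Nonincreasing (q ++ [ w ]) → Admissible n δ (Q ++ [ w ])
    admissible-∷ʳ⁺ {w} app ↘ = Q++w⁺ , LatticePerm-∷ʳ⁺ (lattice cur) app , |Q++w|≤n w ,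
      subst (All Nonincreasing) (sym (blocks-padded w R))
        (Allₚ.++⁺ (blocks↘ cur) (↘-++-ones q++w⁺ ↘ (Allₚ.take⁺ m ones) ∷ blocks-ones-↘ δ₂ (Allₚ.drop⁺ m ones)))
      where
      R = replicate (n ∸ length (Q ++ [ w ])) 1
      ones : Ones R
      ones = Allₚ.replicate⁺ _ refl
      Q++w⁺ : Positive (Q ++ [ w ])
      Q++w⁺ = Allₚ.++⁺ (positive cur) (Appendable⇒pos app ∷ [])
      q++w⁺ : Positive (q ++ [ w ])
      q++w⁺ = Allₚ.++⁻ʳ D (subst Positive (Q++w≡ w) Q++w⁺)

    greedyNext⇒largest : ∀ {x} → IsGreedyNext Q x → Largest≤ (Appendable Q) (lastOr (fresh Q) q) x
    greedyNext⇒largest (_ , adm , max) with admissible-∷ʳ⁻ adm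
    ... | app , ↘ = ∷ʳ-↘⇒≤lastOr q ↘ (Appendable⇒≤fresh app) , app ,
      λ w w≤ appw → max w (Appendable⇒pos appw) (admissible-∷ʳ⁺ appw (≤lastOr⇒∷ʳ-↘ q (q↘ cur) w≤))

    largest⇒greedyNext : ∀ {x} → Largest≤ (Appendable Q) (lastOr (fresh Q) q) x → IsGreedyNext Q x
    largest⇒greedyNext (x≤ , app , max) =
      Appendable⇒pos app , admissible-∷ʳ⁺ app (≤lastOr⇒∷ʳ-↘ q (q↘ cur) x≤) ,
      λ w _ admw → let (appw , ↘w) = admissible-∷ʳ⁻ admw in
                   max w (∷ʳ-↘⇒≤lastOr q ↘w (Appendable⇒≤fresh appw)) appw

  cursor-++-[] : ∀ {δ₁ δ₂ D Q q} → Cursor δ₁ δ₂ D Q q → Cursor δ₁ δ₂ D (Q ++ []) (q ++ [])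
  cursor-++-[] {Q = Q} {q} = subst₂ (Cursor _ _ _) (sym (++-identityʳ Q)) (sym (++-identityʳ q))

  cursor-++-assoc : ∀ {δ₁ δ₂ D Q q x c} → Cursor δ₁ δ₂ D ((Q ++ [ x ]) ++ c) ((q ++ [ x ]) ++ c) →
    Cursor δ₁ δ₂ D (Q ++ x ∷ c) (q ++ x ∷ c)
  cursor-++-assoc {Q = Q} {q} {x} {c} = subst₂ (Cursor _ _ _) (++-assoc Q [ x ] c) (++-assoc q [ x ] c)

  greedyRun⇒greedyBlock : ∀ {δ₁ d δ₂ D Q q} c {rest} → Cursor δ₁ (d ∷ δ₂) D Q q → length q + length c ≡ d →
    GreedyRun Q (c ++ rest) →
    GreedyBlock Q (lastOr (fresh Q) q) c × Cursor δ₁ (d ∷ δ₂) D (Q ++ c) (q ++ c) × GreedyRun (Q ++ c) rest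
  greedyRun⇒greedyBlock {Q = Q} [] {rest} cur _ run =
    tt , cursor-++-[] cur , subst (λ P → GreedyRun P rest) (sym (++-identityʳ Q)) run
  greedyRun⇒greedyBlock {Q = Q} {q} (x ∷ c) {rest} cur len (next , run)
    with greedyNext⇒largest cur (subst (length q <_) len (m<m+n (length q) (s≤s z≤n))) next
  ... | largest@(x≤ , app , _)
    with greedyRun⇒greedyBlock c (cursor-∷ʳ cur app (≤lastOr⇒∷ʳ-↘ q (q↘ cur) x≤)) (length-∷ʳ-+ q len) run
  ... | block , cur′ , run′ =
    (largest , subst (λ u → GreedyBlock (Q ++ [ x ]) u c) (lastOr-∷ʳ _ q x) block) ,
    cursor-++-assoc cur′ ,
    subst (λ P → GreedyRun P rest) (++-assoc Q [ x ] c) run′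

  buildGreedyBlock : ∀ {δ₁ d δ₂ D Q q} k → Cursor δ₁ (d ∷ δ₂) D Q q → length q + k ≡ d →
    Σ (List ℕ) λ c → length c ≡ k × Cursor δ₁ (d ∷ δ₂) D (Q ++ c) (q ++ c) ×
      (∀ {rest} → GreedyRun (Q ++ c) rest → GreedyRun Q (c ++ rest))
  buildGreedyBlock {Q = Q} zero cur _ =
    [] , refl , cursor-++-[] cur , subst (λ P → GreedyRun P _) (++-identityʳ Q)
  buildGreedyBlock {D = D} {Q} {q} (suc k) cur len
    with largest≤ (appendable? Q) (lastOr (fresh Q) q) (lastOr-pos q (s≤s z≤n) q⁺) one
    where
    q⁺ : Positive q
    q⁺ = Allₚ.++⁻ʳ D (subst Positive (split cur) (positive cur))
  ... | x , largest@(x≤ , app , _)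
    with buildGreedyBlock k (cursor-∷ʳ cur app (≤lastOr⇒∷ʳ-↘ q (q↘ cur) x≤)) (length-∷ʳ-+ q len)
  ... | c , |c|≡k , cur′ , extend =
    x ∷ c , cong suc |c|≡k , cursor-++-assoc cur′ ,
    λ run → largest⇒greedyNext cur (subst (length q <_) len (m<m+n (length q) (s≤s z≤n))) largest ,
            extend (subst (λ P → GreedyRun P _) (sym (++-assoc Q [ x ] c)) run)

  buildGreedyRun : ∀ δ₂ {δ₁ D} → Cursor δ₁ δ₂ D D [] →
    Σ (List ℕ) λ rest → length rest ≡ sum δ₂ × GreedyRun D rest
  buildGreedyRun []       _   = [] , refl , tt
  buildGreedyRun (d ∷ δ₂) cur with buildGreedyBlock d cur refl
  ... | c , |c|≡d , cur′ , extend with buildGreedyRun δ₂ (cursor-next cur′ |c|≡d)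
  ... | rest , |rest|≡ , run = c ++ rest , trans (length-++ c) (cong₂ _+_ |c|≡d |rest|≡) , extend run

  greedyRun-psum : ∀ δ₂ {δ₁ D rest S} → Cursor δ₁ δ₂ D D [] → length rest ≡ sum δ₂ → GreedyRun D rest →
    Nonincreasing S → (∀ r → psum (content D) r ≡ sum (take r S)) →
    ∀ r → psum (content (D ++ rest)) r ≡ sum (take r (insertAll δ₂ S))
  greedyRun-psum [] {D = D} {[]} _ _ _ _ eq r = trans (cong (λ P → psum (content P) r) (++-identityʳ D)) (eq r)
  greedyRun-psum (d ∷ δ₂) {D = D} {rest} {S} cur |rest|≡ run S↘ eq
    with greedyRun⇒greedyBlock (take d rest) cur (length-take-≡ rest |rest|≡)
           (subst (GreedyRun D) (sym (take++drop≡id d rest)) run)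
  ... | greedy , cur′ , run′ = λ r → trans (cong (λ P → psum (content P) r) (sym (++-take++drop D d rest)))
    (greedyRun-psum δ₂ (cursor-next cur′ |b|≡d) (length-drop-≡ rest |rest|≡) run′ (Insertion.insert-↗ d S↘) step r)
    where
    b : List ℕ
    b = take d rest
    |b|≡d : length b ≡ d
    |b|≡d = length-take-≡ rest |rest|≡
    b⁺ : Positive b
    b⁺ = Allₚ.++⁻ʳ D (positive cur′)
    step : ∀ r → psum (content (D ++ b)) r ≡ sum (take r (insert d S))
    step r = ≤-antisym
      (psum-≤-sum-take-insert S↘ b⁺ |b|≡d greedy (lattice cur) eq r)
      (sum-take-insert-≤-psum S↘ (q↘ cur′) b⁺ |b|≡d (lattice cur′) (λ r → ≤-reflexive (sym (eq r))) r)

proposition6p6 : (n : ℕ) (δ : List ℕ) → IsComposition n δ →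
    (Σ (List ℕ) λ ω̂ → IsMinimalSeq n δ ω̂) ×
    ((ω ω̂ : List ℕ) → InΩ n δ ω → IsMinimalSeq n δ ω̂ →
      ((i : ℕ) → content ω̂ (suc i) ≡ entry (srt δ) (suc i)) ×
      Dominated (content ω̂) (content ω))
proposition6p6 n δ (_ , Σδ≡n) = existence , λ ω ω̂ ω∈Ω minimal →
    psum≡sum-take⇒content≡entry ω̂ (psum-minimal minimal) ,
    λ r → subst (_≤ _) (sym (psum-minimal minimal r)) (lower-bound ω∈Ω r)
  where
  open Greedy n δ
  n≡Σδ : n ≡ sum δ
  n≡Σδ = sym Σδ≡n
  psum-[] : ∀ r → psum (content []) r ≡ sum (take r [])
  psum-[] r = trans (psum-content-[] r) (sym (sum-take-[] r))

  existence : Σ (List ℕ) λ ω̂ → IsMinimalSeq n δ ω̂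
  existence with buildGreedyRun n≡Σδ δ (cursor-start n≡Σδ)
  ... | ω̂ , |ω̂|≡ , run = ω̂ , greedyRun⇒minimal run (trans |ω̂|≡ Σδ≡n)

  psum-minimal : ∀ {ω̂} → IsMinimalSeq n δ ω̂ → ∀ r → psum (content ω̂) r ≡ sum (take r (srt δ))
  psum-minimal minimal@(|ω̂|≡n , _) r rewrite srt≡insertAll δ =
    greedyRun-psum n≡Σδ δ (cursor-start n≡Σδ) (trans |ω̂|≡n n≡Σδ) (minimal⇒greedyRun minimal) [] psum-[] r

  lower-bound : ∀ {ω} → InΩ n δ ω → ∀ r → sum (take r (srt δ)) ≤ psum (content ω) r
  lower-bound (|ω|≡n , ω⁺ , L , ω↘) r rewrite srt≡insertAll δ =
    sum-take-insertAll-≤-psum δ [] (DeltaNonincreasing-full |ω|≡n ω↘) ω⁺ (trans |ω|≡n n≡Σδ) L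
      (λ r → ≤-reflexive (sym (psum-[] r))) r
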